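{- Let $1\leq k<s$. Then the Laplacian spectrum of the spider $T(s,k)$ (as a multiset) is $$\{0^{[1]},\ \theta^{[k-1]},\ \lambda_1^{[1]},\ 1^{[s-k-1]},\ \lambda_2^{[1]},\ \overline{\theta}^{[k-1]},\ \lambda_3^{[1]}\},$$ where $\theta=\frac{3-\sqrt5}{2}$, $\overline{\theta}=\frac{3+\sqrt5}{2}$, and $\lambda_1,\lambda_2,\lambda_3$ are the roots of $x^3-(s+4)x^2+(3s+4)x-(s+k+1)$.
   Context: For integers $1\leq k\leq s$, the spider $T(s,k)$ is the tree obtained from the star $K_{1,s}$ by extending $k$ of its $s$ rays (edges from the center) by one extra edge each; it has $n=s+k+1$ vertices. The Laplacian spectrum is the multiset of eigenvalues of $L=D-A$ ($D$ the diagonal degree matrix, $A$ the adjacency matrix); $x^{[m]}$ indicates eigenvalue $x$ with multiplicity $m$. -}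

module Defs where

open import Data.Nat as ℕ using (ℕ; zero; suc; _≡ᵇ_; _≤ᵇ_)
open import Data.Bool using (Bool; true; false; _∧_; _∨_; if_then_else_)
open import Data.Fin using (Fin; toℕ; punchIn) renaming (zero to fzero; suc to fsuc)
open import Data.Integer using (ℤ; +_; _+_; _-_; _*_; -_; _^_)

Σℤ : (n : ℕ) → (Fin n → ℤ) → ℤ
Σℤ zero    f = + 0
Σℤ (suc n) f = f fzero + Σℤ n (λ i → f (fsuc i))

Matrix : ℕ → Set
Matrix n = Fin n → Fin n → ℤ

sgn : ℕ → ℤ
sgn zero          = + 1
sgn (suc zero)    = - (+ 1)
sgn (suc (suc i)) = sgn i

det : (n : ℕ) → Matrix n → ℤ
det zero    M = + 1
det (suc n) M =
  Σℤ (suc n) (λ j → sgn (toℕ j) * M fzero j * det n (λ a b → M (fsuc a) (punchIn j b)))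

Graph : ℕ → Set
Graph n = Fin n → Fin n → Bool

adjacencyMatrix : {n : ℕ} → Graph n → Matrix n
adjacencyMatrix G u v = if G u v then + 1 else + 0

degree : {n : ℕ} → Graph n → Fin n → ℤ
degree {n} G u = Σℤ n (λ v → adjacencyMatrix G u v)

laplacian : {n : ℕ} → Graph n → Matrix n
laplacian G u v = (if toℕ u ≡ᵇ toℕ v then degree G u else + 0) - adjacencyMatrix G u v

charPolyAt : {n : ℕ} → Matrix n → ℤ → ℤ
charPolyAt {n} M x = det n (λ u v → (if toℕ u ≡ᵇ toℕ v then x else + 0) - M u v)

-- The spider T(s,k) on vertices 0,…,s+k (n = s+k+1):
-- 0 is the centre, 1,…,s are its neighbours (the s rays),
-- and for 1 ≤ i ≤ k the vertex s+i is a pendant vertex attached to i.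
spiderAdj : (s k : ℕ) → ℕ → ℕ → Bool
spiderAdj s k u v =
  ((u ≡ᵇ 0) ∧ (1 ≤ᵇ v) ∧ (v ≤ᵇ s))
  ∨ ((1 ≤ᵇ u) ∧ (u ≤ᵇ k) ∧ (v ≡ᵇ s ℕ.+ u))

spider : (s k : ℕ) → Graph (s ℕ.+ k ℕ.+ 1)
spider s k u v = spiderAdj s k (toℕ u) (toℕ v) ∨ spiderAdj s k (toℕ v) (toℕ u)

-- Let F(s,k,y) be the determinant of xI - L(T(s,k)) with the centre's diagonal entry replaced by y, so
-- that the characteristic polynomial is F(s,k,x-s). Expanding along the row and then the column of a
-- pendant vertex v with neighbour u gives det M = m_vv det(M-v) - m_uv m_vu det(M-u-v). For a ray leaf
-- (u the centre) and for the foot of a leg (u its root) this yields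
--   F(s+1,k,y)   = (x-1) F(s,k,y) - G(s,k),
--   F(s+1,k+1,y) = (x-1) (F(s+1,k,y) - F(s,k,y)) - F(s,k,y),
-- where G(s,k), the determinant of the forest T(s,k) - centre, is the slope of the affine map y ↦ F(s,k,y),
-- and the difference in the second line comes from linearity in the diagonal entry of the root.
-- With E = x-1 and P = x²-3x+1, induction on the numbers of legs and rays then gives
--   F(k+b,k,y) = y E^b P^k - k E^(b+1) P^(k-1) - b E^(b-1) P^k,
-- which at y = x-s factors as x P^(k-1) E^(s-k-1) (x³ - (s+4)x² + (3s+4)x - (s+k+1)).

module Submission where

open import Defs
open import Data.Bool using (Bool; true; false; if_then_else_)
open import Data.Empty using (⊥-elim)
open import Data.Fin using (Fin; toℕ; punchIn; fromℕ<) renaming (zero to fzero; suc to fsuc)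
open import Data.Fin.Properties using (punchIn-injective; punchInᵢ≢i; suc-injective; toℕ-injective; toℕ<n; toℕ-fromℕ<)
open import Data.Integer using (ℤ; +_; -_; _+_; _-_; _*_; _^_; -1ℤ)
open import Data.Integer.Tactic.RingSolver using (solve-∀)
open import Data.Nat using (ℕ; zero; suc; z≤n; s≤s; _≤_; _<_; _∸_; _≡ᵇ_; _<ᵇ_)
open import Data.Nat.Properties using (_≟_; _<?_; _≤?_)
open import Data.Product using (_×_; _,_)
open import Data.Sum using (_⊎_; inj₁; inj₂; reduce; swap)
open import Data.Sum.Function.Propositional using (_⊎-⇔_)
open import Data.Vec.Functional using (map)
open import Function using (_∘_)
open import Function.Bundles using (_⇔_; mk⇔; Equivalence)
open import Relation.Binary.PropositionalEquality
  using (_≡_; _≢_; refl; sym; trans; cong; cong₂; subst; module ≡-Reasoning)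
open import Relation.Nullary using (¬_; yes; no)
open import Relation.Nullary.Decidable using (Dec; does; _×-dec_; _⊎-dec_; does-⇔; dec-true; dec-false)
import Data.Integer.Properties as ℤP
import Data.Nat as N
import Data.Nat.Properties as ℕP
open import Algebra.Properties.Semiring.Sum ℤP.+-*-semiring
  using (sum; sum-cong-≗; sum-remove; ∑-distrib-+; *-distribˡ-sum; sum-replicate-zero)

Σℤ≡sum : ∀ n (f : Fin n → ℤ) → Σℤ n f ≡ sum f
Σℤ≡sum zero    f = refl
Σℤ≡sum (suc n) f = cong (_+_ (f fzero)) (Σℤ≡sum n (f ∘ fsuc))

Σℤ-cong : ∀ n {f g : Fin n → ℤ} → (∀ i → f i ≡ g i) → Σℤ n f ≡ Σℤ n g
Σℤ-cong n {f} {g} f≗g = trans (Σℤ≡sum n f) (trans (sum-cong-≗ f≗g) (sym (Σℤ≡sum n g)))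

Σℤ-zero : ∀ n {f : Fin n → ℤ} → (∀ i → f i ≡ + 0) → Σℤ n f ≡ + 0
Σℤ-zero n {f} f≗0 = trans (Σℤ≡sum n f) (trans (sum-cong-≗ f≗0) (sum-replicate-zero n))

Σℤ-remove : ∀ n (f : Fin (suc n) → ℤ) i → Σℤ (suc n) f ≡ f i + Σℤ n (f ∘ punchIn i)
Σℤ-remove n f i =
  trans (Σℤ≡sum (suc n) f) (trans (sum-remove f) (cong (_+_ (f i)) (sym (Σℤ≡sum n (f ∘ punchIn i)))))

Σℤ-*ˡ : ∀ n (c : ℤ) (f : Fin n → ℤ) → Σℤ n (λ i → c * f i) ≡ c * Σℤ n f
Σℤ-*ˡ n c f = begin
  Σℤ n (λ i → c * f i) ≡⟨ Σℤ≡sum n _ ⟩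
  sum (map (c *_) f)   ≡⟨ *-distribˡ-sum c f ⟨
  c * sum f            ≡⟨ cong (c *_) (Σℤ≡sum n f) ⟨
  c * Σℤ n f           ∎
  where open ≡-Reasoning

Σℤ-+ : ∀ n (f g : Fin n → ℤ) → Σℤ n (λ i → f i + g i) ≡ Σℤ n f + Σℤ n g
Σℤ-+ n f g = begin
  Σℤ n (λ i → f i + g i)   ≡⟨ Σℤ≡sum n _ ⟩
  sum (λ i → f i + g i)    ≡⟨ ∑-distrib-+ f g ⟩
  sum f + sum g            ≡⟨ cong₂ _+_ (Σℤ≡sum n f) (Σℤ≡sum n g) ⟨
  Σℤ n f + Σℤ n g          ∎
  where open ≡-Reasoning

Σℤ-linear : ∀ n (c d : ℤ) (f g : Fin n → ℤ) →
            Σℤ n (λ i → c * f i + d * g i) ≡ c * Σℤ n f + d * Σℤ n g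
Σℤ-linear n c d f g =
  trans (Σℤ-+ n (λ i → c * f i) (λ i → d * g i)) (cong₂ _+_ (Σℤ-*ˡ n c f) (Σℤ-*ˡ n d g))

sgn≡-1^ : ∀ n → sgn n ≡ -1ℤ ^ n
sgn≡-1^ zero          = refl
sgn≡-1^ (suc zero)    = refl
sgn≡-1^ (suc (suc n)) = trans (sgn≡-1^ n) (square-neg-one (-1ℤ ^ n))
  where
  square-neg-one : ∀ i → i ≡ -1ℤ * (-1ℤ * i)
  square-neg-one = solve-∀

sgn-+ : ∀ m n → sgn (m N.+ n) ≡ sgn m * sgn n
sgn-+ m n = begin
  sgn (m N.+ n)       ≡⟨ sgn≡-1^ (m N.+ n) ⟩
  -1ℤ ^ (m N.+ n)     ≡⟨ ℤP.^-distribˡ-+-* -1ℤ m n ⟩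
  -1ℤ ^ m * -1ℤ ^ n   ≡⟨ cong₂ _*_ (sgn≡-1^ m) (sgn≡-1^ n) ⟨
  sgn m * sgn n       ∎
  where open ≡-Reasoning

sgn-suc : ∀ n → sgn (suc n) ≡ - sgn n
sgn-suc n = trans (sgn-+ 1 n) (ℤP.-1*i≡-i (sgn n))

sgn-double : ∀ n → sgn (n N.+ n) ≡ + 1
sgn-double zero    = refl
sgn-double (suc n) = trans (cong (sgn ∘ suc) (ℕP.+-suc n n)) (sgn-double n)

sgn-square : ∀ n → sgn n * sgn n ≡ + 1
sgn-square zero          = refl
sgn-square (suc zero)    = refl
sgn-square (suc (suc n)) = sgn-square n

sgn-adjacent : ∀ u v → sgn (suc v N.+ u) * sgn (u N.+ v) ≡ -1ℤ
sgn-adjacent u v = begin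
  sgn (suc (v N.+ u)) * sgn (u N.+ v)   ≡⟨ cong₂ (λ x y → x * sgn y) (sgn-suc (v N.+ u)) (ℕP.+-comm u v) ⟩
  - sgn (v N.+ u) * sgn (v N.+ u)       ≡⟨ ℤP.neg-distribˡ-* (sgn (v N.+ u)) (sgn (v N.+ u)) ⟨
  - (sgn (v N.+ u) * sgn (v N.+ u))     ≡⟨ cong -_ (sgn-square (v N.+ u)) ⟩
  -1ℤ                                   ∎
  where open ≡-Reasoning

-- Cofactor expansion

minor : ∀ {n} → Fin (suc n) → Fin (suc n) → Matrix (suc n) → Matrix n
minor r c M a b = M (punchIn r a) (punchIn c b)

laplaceTerm : ∀ {n} → Fin (suc n) → Fin (suc n) → Matrix (suc n) → ℤ
laplaceTerm {n} r c M = sgn (toℕ r N.+ toℕ c) * M r c * det n (minor r c M)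

det-cong : ∀ n {M M′ : Matrix n} → (∀ a b → M a b ≡ M′ a b) → det n M ≡ det n M′
det-cong zero    M≗M′ = refl
det-cong (suc n) M≗M′ = Σℤ-cong (suc n) λ c →
  cong₂ (λ m d → sgn (toℕ c) * m * d) (M≗M′ fzero c) (det-cong n λ a b → M≗M′ (fsuc a) (punchIn c b))

laplaceTerm-zero-entry : ∀ {n} (M : Matrix (suc n)) r c → M r c ≡ + 0 → laplaceTerm r c M ≡ + 0
laplaceTerm-zero-entry {n} M r c Mrc≡0 = begin
  sgn (toℕ r N.+ toℕ c) * M r c * det n (minor r c M) ≡⟨ cong (λ m → sgn (toℕ r N.+ toℕ c) * m * det n (minor r c M)) Mrc≡0 ⟩
  sgn (toℕ r N.+ toℕ c) * + 0 * det n (minor r c M)   ≡⟨ cong (_* det n (minor r c M)) (ℤP.*-zeroʳ (sgn (toℕ r N.+ toℕ c))) ⟩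
  + 0                                                 ∎
  where open ≡-Reasoning

laplaceTerm-zero-minor : ∀ {n} (M : Matrix (suc n)) r c → det n (minor r c M) ≡ + 0 → laplaceTerm r c M ≡ + 0
laplaceTerm-zero-minor M r c det≡0 =
  trans (cong (sgn (toℕ r N.+ toℕ c) * M r c *_) det≡0) (ℤP.*-zeroʳ (sgn (toℕ r N.+ toℕ c) * M r c))

det≡laplaceTerm₀ : ∀ n (M : Matrix (suc n)) c → (∀ l → laplaceTerm fzero (punchIn c l) M ≡ + 0) →
                       det (suc n) M ≡ laplaceTerm fzero c M
det≡laplaceTerm₀ n M c others≡0 = begin
  det (suc n) M
    ≡⟨ Σℤ-remove n (λ j → laplaceTerm fzero j M) c ⟩
  laplaceTerm fzero c M + Σℤ n (λ l → laplaceTerm fzero (punchIn c l) M)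
    ≡⟨ cong (_+_ (laplaceTerm fzero c M)) (Σℤ-zero n others≡0) ⟩
  laplaceTerm fzero c M + + 0
    ≡⟨ ℤP.+-identityʳ (laplaceTerm fzero c M) ⟩
  laplaceTerm fzero c M ∎
  where open ≡-Reasoning

det-zero-row : ∀ n (M : Matrix n) r → (∀ b → M r b ≡ + 0) → det n M ≡ + 0
det-zero-row (suc n) M fzero    row≡0 = Σℤ-zero (suc n) λ c → laplaceTerm-zero-entry M fzero c (row≡0 c)
det-zero-row (suc n) M (fsuc r) row≡0 = Σℤ-zero (suc n) λ c →
  laplaceTerm-zero-minor M fzero c (det-zero-row n (minor fzero c M) r λ b → row≡0 (punchIn c b))

-- Column c of M is column pivot c l of M with column punchIn c l deleted.
pivot : ∀ {n} → Fin (suc n) → Fin n → Fin n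
pivot {suc n} fzero    l        = fzero
pivot         (fsuc c) fzero    = c
pivot         (fsuc c) (fsuc l) = fsuc (pivot c l)

punchIn-pivot : ∀ {n} (c : Fin (suc n)) l → punchIn (punchIn c l) (pivot c l) ≡ c
punchIn-pivot {suc n} fzero    l        = refl
punchIn-pivot         (fsuc c) fzero    = refl
punchIn-pivot         (fsuc c) (fsuc l) = cong fsuc (punchIn-pivot c l)

punchIn-punchIn-pivot : ∀ {n} (c : Fin (suc (suc n))) l b →
                        punchIn (punchIn c l) (punchIn (pivot c l) b) ≡ punchIn c (punchIn l b)
punchIn-punchIn-pivot fzero    l        b        = refl
punchIn-punchIn-pivot (fsuc c) fzero    b        = refl
punchIn-punchIn-pivot (fsuc c) (fsuc l) fzero    = refl
punchIn-punchIn-pivot (fsuc c) (fsuc l) (fsuc b) = cong fsuc (punchIn-punchIn-pivot c l b)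

sgn-pivot : ∀ {n} (c : Fin (suc n)) l →
            sgn (toℕ (punchIn c l) N.+ toℕ (pivot c l)) ≡ - sgn (toℕ c N.+ toℕ l)
sgn-pivot {suc n} fzero l = begin
  sgn (suc (toℕ l) N.+ 0) ≡⟨ cong (sgn ∘ suc) (ℕP.+-identityʳ (toℕ l)) ⟩
  sgn (suc (toℕ l))       ≡⟨ sgn-suc (toℕ l) ⟩
  - sgn (toℕ l)           ∎
  where open ≡-Reasoning
sgn-pivot (fsuc c) fzero = begin
  sgn (toℕ c)                 ≡⟨ ℤP.neg-involutive (sgn (toℕ c)) ⟨
  - - sgn (toℕ c)             ≡⟨ cong -_ (sgn-suc (toℕ c)) ⟨
  - sgn (suc (toℕ c))         ≡⟨ cong (λ i → - sgn (suc i)) (ℕP.+-identityʳ (toℕ c)) ⟨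
  - sgn (suc (toℕ c) N.+ 0)   ∎
  where open ≡-Reasoning
sgn-pivot (fsuc c) (fsuc l) = begin
  sgn (suc (toℕ (punchIn c l)) N.+ suc (toℕ (pivot c l))) ≡⟨ sgn-suc-+-suc (toℕ (punchIn c l)) (toℕ (pivot c l)) ⟩
  sgn (toℕ (punchIn c l) N.+ toℕ (pivot c l))             ≡⟨ sgn-pivot c l ⟩
  - sgn (toℕ c N.+ toℕ l)                                 ≡⟨ cong -_ (sgn-suc-+-suc (toℕ c) (toℕ l)) ⟨
  - sgn (suc (toℕ c) N.+ suc (toℕ l))                     ∎
  where
  open ≡-Reasoning
  sgn-suc-+-suc : ∀ m n → sgn (suc m N.+ suc n) ≡ sgn (m N.+ n)
  sgn-suc-+-suc m n = cong (sgn ∘ suc) (ℕP.+-suc m n)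

det-zero-col : ∀ n (M : Matrix n) c → (∀ a → M a c ≡ + 0) → det n M ≡ + 0
det-zero-col (suc n) M c col≡0 = begin
  det (suc n) M
    ≡⟨ Σℤ-remove n (λ j → laplaceTerm fzero j M) c ⟩
  laplaceTerm fzero c M + Σℤ n (λ l → laplaceTerm fzero (punchIn c l) M)
    ≡⟨ cong₂ _+_ (laplaceTerm-zero-entry M fzero c (col≡0 fzero))
                 (Σℤ-zero n λ l → laplaceTerm-zero-minor M fzero (punchIn c l) (minor-col≡0 l)) ⟩
  + 0 ∎
  where
  open ≡-Reasoning
  minor-col≡0 : ∀ l → det n (minor fzero (punchIn c l) M) ≡ + 0
  minor-col≡0 l = det-zero-col n (minor fzero (punchIn c l) M) (pivot c l)
    λ a → trans (cong (M (fsuc a)) (punchIn-pivot c l)) (col≡0 (fsuc a))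

sgn-punchIn-pivot : ∀ {n} r (c : Fin (suc n)) l →
           sgn (toℕ (punchIn c l)) * sgn (r N.+ toℕ (pivot c l)) ≡ sgn (suc r N.+ toℕ c) * sgn (toℕ l)
sgn-punchIn-pivot r c l = begin
  J * sgn (r N.+ toℕ c′)          ≡⟨ cong (J *_) (sgn-+ r (toℕ c′)) ⟩
  J * (R * C′)                    ≡⟨ exchange J R C′ ⟩
  R * (J * C′)                    ≡⟨ cong (R *_) (sgn-+ (toℕ j) (toℕ c′)) ⟨
  R * sgn (toℕ j N.+ toℕ c′)      ≡⟨ cong (R *_) (sgn-pivot c l) ⟩
  R * - sgn (toℕ c N.+ toℕ l)     ≡⟨ cong (λ z → R * - z) (sgn-+ (toℕ c) (toℕ l)) ⟩
  R * - (C * L)                   ≡⟨ pull-neg R C L ⟩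
  - (R * C) * L                   ≡⟨ cong (λ z → - z * L) (sgn-+ r (toℕ c)) ⟨
  - sgn (r N.+ toℕ c) * L         ≡⟨ cong (_* L) (sgn-suc (r N.+ toℕ c)) ⟨
  sgn (suc r N.+ toℕ c) * L       ∎
  where
  open ≡-Reasoning
  j = punchIn c l
  c′ = pivot c l
  J = sgn (toℕ j)
  R = sgn r
  C′ = sgn (toℕ c′)
  C = sgn (toℕ c)
  L = sgn (toℕ l)
  exchange : ∀ x y z → x * (y * z) ≡ y * (x * z)
  exchange = solve-∀
  pull-neg : ∀ x y z → x * - (y * z) ≡ - (x * y) * z
  pull-neg = solve-∀

laplaceTerm-punchIn : ∀ n (M : Matrix (suc (suc n))) r c l →
  det (suc n) (minor fzero (punchIn c l) M) ≡ laplaceTerm r (pivot c l) (minor fzero (punchIn c l) M) →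
  laplaceTerm fzero (punchIn c l) M ≡ sgn (toℕ (fsuc r) N.+ toℕ c) * M (fsuc r) c * laplaceTerm fzero l (minor (fsuc r) c M)
laplaceTerm-punchIn n M r c l expand = begin
  sgn (toℕ j) * M fzero j * det (suc n) (minor fzero j M)
    ≡⟨ cong (sgn (toℕ j) * M fzero j *_) expand ⟩
  sgn (toℕ j) * M fzero j * (sgn (toℕ r N.+ toℕ c′) * M (fsuc r) (punchIn j c′) * det n (minor r c′ (minor fzero j M)))
    ≡⟨ cong₂ (λ m d → sgn (toℕ j) * M fzero j * (sgn (toℕ r N.+ toℕ c′) * m * d))
             (cong (M (fsuc r)) (punchIn-pivot c l))
             (det-cong n λ a b → cong (M (fsuc (punchIn r a))) (punchIn-punchIn-pivot c l b)) ⟩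
  sgn (toℕ j) * M fzero j * (sgn (toℕ r N.+ toℕ c′) * M (fsuc r) c * D)
    ≡⟨ rearrange (sgn (toℕ j)) (sgn (toℕ r N.+ toℕ c′)) (sgn (suc (toℕ r) N.+ toℕ c)) (sgn (toℕ l))
                 (M fzero j) (M (fsuc r) c) D (sgn-punchIn-pivot (toℕ r) c l) ⟩
  sgn (suc (toℕ r) N.+ toℕ c) * M (fsuc r) c * (sgn (toℕ l) * M fzero j * D) ∎
  where
  open ≡-Reasoning
  j = punchIn c l
  c′ = pivot c l
  D = det n (minor fzero l (minor (fsuc r) c M))
  rearrange : ∀ S T L A B E F → S * T ≡ L * A → S * B * (T * E * F) ≡ L * E * (A * B * F)
  rearrange S T L A B E F ST≡LA = begin
    S * B * (T * E * F)   ≡⟨ regroup S T B E F ⟩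
    S * T * (B * E * F)   ≡⟨ cong (_* (B * E * F)) ST≡LA ⟩
    L * A * (B * E * F)   ≡⟨ regroup′ L A B E F ⟩
    L * E * (A * B * F)   ∎
    where
    regroup : ∀ s t b e f → s * b * (t * e * f) ≡ s * t * (b * e * f)
    regroup = solve-∀
    regroup′ : ∀ l a b e f → l * a * (b * e * f) ≡ l * e * (a * b * f)
    regroup′ = solve-∀

det≡laplaceTerm-lift : ∀ n (M : Matrix (suc (suc n))) r c → laplaceTerm fzero c M ≡ + 0 →
  (∀ l → det (suc n) (minor fzero (punchIn c l) M) ≡ laplaceTerm r (pivot c l) (minor fzero (punchIn c l) M)) →
  det (suc (suc n)) M ≡ laplaceTerm (fsuc r) c M
det≡laplaceTerm-lift n M r c term≡0 expand = begin
  det (suc (suc n)) M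
    ≡⟨ Σℤ-remove (suc n) (λ j → laplaceTerm fzero j M) c ⟩
  laplaceTerm fzero c M + Σℤ (suc n) (λ l → laplaceTerm fzero (punchIn c l) M)
    ≡⟨ cong₂ _+_ term≡0 (Σℤ-cong (suc n) λ l → laplaceTerm-punchIn n M r c l (expand l)) ⟩
  + 0 + Σℤ (suc n) (λ l → K * laplaceTerm fzero l (minor (fsuc r) c M))
    ≡⟨ ℤP.+-identityˡ _ ⟩
  Σℤ (suc n) (λ l → K * laplaceTerm fzero l (minor (fsuc r) c M))
    ≡⟨ Σℤ-*ˡ (suc n) K (λ l → laplaceTerm fzero l (minor (fsuc r) c M)) ⟩
  K * det (suc n) (minor (fsuc r) c M) ∎
  where
  open ≡-Reasoning
  K = sgn (toℕ (fsuc r) N.+ toℕ c) * M (fsuc r) c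

det-row-single : ∀ n (M : Matrix (suc n)) r c → (∀ b → b ≢ c → M r b ≡ + 0) → det (suc n) M ≡ laplaceTerm r c M
det-row-single n M fzero c row≡0 =
  det≡laplaceTerm₀ n M c λ l → laplaceTerm-zero-entry M fzero (punchIn c l) (row≡0 _ (punchInᵢ≢i c l))
det-row-single (suc n) M (fsuc r) c row≡0 = det≡laplaceTerm-lift n M r c
  (laplaceTerm-zero-minor M fzero c (det-zero-row (suc n) (minor fzero c M) r λ b → row≡0 _ (punchInᵢ≢i c b)))
  λ l → det-row-single n (minor fzero (punchIn c l) M) r (pivot c l) λ b b≢c′ →
    row≡0 _ λ eq → b≢c′ (punchIn-injective (punchIn c l) b (pivot c l) (trans eq (sym (punchIn-pivot c l))))

det-col-single : ∀ n (M : Matrix (suc n)) r c → (∀ a → a ≢ r → M a c ≡ + 0) → det (suc n) M ≡ laplaceTerm r c M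
det-col-single n M fzero c col≡0 =
  det≡laplaceTerm₀ n M c λ l → laplaceTerm-zero-minor M fzero (punchIn c l)
    (det-zero-col n (minor fzero (punchIn c l) M) (pivot c l) λ a →
      trans (cong (M (fsuc a)) (punchIn-pivot c l)) (col≡0 (fsuc a) λ ()))
det-col-single (suc n) M (fsuc r) c col≡0 = det≡laplaceTerm-lift n M r c
  (laplaceTerm-zero-entry M fzero c (col≡0 fzero λ ()))
  λ l → det-col-single n (minor fzero (punchIn c l) M) r (pivot c l) λ a a≢r →
    trans (cong (M (fsuc a)) (punchIn-pivot c l)) (col≡0 (fsuc a) (a≢r ∘ suc-injective))

det-row-linear : ∀ n (M M₁ M₂ : Matrix n) r (c₁ c₂ : ℤ) →
  (∀ a → a ≢ r → ∀ b → M a b ≡ M₁ a b) → (∀ a → a ≢ r → ∀ b → M a b ≡ M₂ a b) →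
  (∀ b → M r b ≡ c₁ * M₁ r b + c₂ * M₂ r b) → det n M ≡ c₁ * det n M₁ + c₂ * det n M₂

laplaceTerm-row-linear : ∀ n (M M₁ M₂ : Matrix (suc n)) r (c₁ c₂ : ℤ) →
  (∀ a → a ≢ r → ∀ b → M a b ≡ M₁ a b) → (∀ a → a ≢ r → ∀ b → M a b ≡ M₂ a b) →
  (∀ b → M r b ≡ c₁ * M₁ r b + c₂ * M₂ r b) →
  ∀ j → laplaceTerm fzero j M ≡ c₁ * laplaceTerm fzero j M₁ + c₂ * laplaceTerm fzero j M₂

det-row-linear (suc n) M M₁ M₂ r c₁ c₂ M≗M₁ M≗M₂ row =
  trans (Σℤ-cong (suc n) (laplaceTerm-row-linear n M M₁ M₂ r c₁ c₂ M≗M₁ M≗M₂ row))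
        (Σℤ-linear (suc n) c₁ c₂ (λ j → laplaceTerm fzero j M₁) (λ j → laplaceTerm fzero j M₂))

laplaceTerm-row-linear n M M₁ M₂ fzero c₁ c₂ M≗M₁ M≗M₂ row j = begin
  sgn (toℕ j) * M fzero j * D                               ≡⟨ cong (λ m → sgn (toℕ j) * m * D) (row j) ⟩
  sgn (toℕ j) * (c₁ * M₁ fzero j + c₂ * M₂ fzero j) * D     ≡⟨ distribute (sgn (toℕ j)) c₁ c₂ (M₁ fzero j) (M₂ fzero j) D ⟩
  c₁ * (sgn (toℕ j) * M₁ fzero j * D) + c₂ * (sgn (toℕ j) * M₂ fzero j * D)
    ≡⟨ cong₂ (λ d₁ d₂ → c₁ * (sgn (toℕ j) * M₁ fzero j * d₁) + c₂ * (sgn (toℕ j) * M₂ fzero j * d₂))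
             (det-cong n λ a b → M≗M₁ (fsuc a) (λ ()) (punchIn j b))
             (det-cong n λ a b → M≗M₂ (fsuc a) (λ ()) (punchIn j b)) ⟩
  c₁ * laplaceTerm fzero j M₁ + c₂ * laplaceTerm fzero j M₂ ∎
  where
  open ≡-Reasoning
  D = det n (minor fzero j M)
  distribute : ∀ s x y u v d → s * (x * u + y * v) * d ≡ x * (s * u * d) + y * (s * v * d)
  distribute = solve-∀
laplaceTerm-row-linear n M M₁ M₂ (fsuc r) c₁ c₂ M≗M₁ M≗M₂ row j = begin
  sgn (toℕ j) * M fzero j * det n (minor fzero j M)
    ≡⟨ cong (sgn (toℕ j) * M fzero j *_)
            (det-row-linear n (minor fzero j M) (minor fzero j M₁) (minor fzero j M₂) r c₁ c₂
               (λ a a≢r b → M≗M₁ (fsuc a) (a≢r ∘ suc-injective) (punchIn j b))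
               (λ a a≢r b → M≗M₂ (fsuc a) (a≢r ∘ suc-injective) (punchIn j b))
               (λ b → row (punchIn j b))) ⟩
  sgn (toℕ j) * M fzero j * (c₁ * D₁ + c₂ * D₂)
    ≡⟨ distribute (sgn (toℕ j)) (M fzero j) c₁ c₂ D₁ D₂ ⟩
  c₁ * (sgn (toℕ j) * M fzero j * D₁) + c₂ * (sgn (toℕ j) * M fzero j * D₂)
    ≡⟨ cong₂ (λ m₁ m₂ → c₁ * (sgn (toℕ j) * m₁ * D₁) + c₂ * (sgn (toℕ j) * m₂ * D₂))
             (M≗M₁ fzero (λ ()) j) (M≗M₂ fzero (λ ()) j) ⟩
  c₁ * laplaceTerm fzero j M₁ + c₂ * laplaceTerm fzero j M₂ ∎
  where
  open ≡-Reasoning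
  D₁ = det n (minor fzero j M₁)
  D₂ = det n (minor fzero j M₂)
  distribute : ∀ s m x y u v → s * m * (x * u + y * v) ≡ x * (s * m * u) + y * (s * m * v)
  distribute = solve-∀

-- Matrices indexed by ℕ

skip : ℕ → ℕ → ℕ
skip zero    a       = suc a
skip (suc p) zero    = zero
skip (suc p) (suc a) = suc (skip p a)

toℕ-punchIn : ∀ {n} (i : Fin (suc n)) j → toℕ (punchIn i j) ≡ skip (toℕ i) (toℕ j)
toℕ-punchIn fzero    j        = refl
toℕ-punchIn (fsuc i) fzero    = refl
toℕ-punchIn (fsuc i) (fsuc j) = cong suc (toℕ-punchIn i j)

skip-< : ∀ {p a} → a < p → skip p a ≡ a
skip-< {suc p} {zero}  a<p = refl
skip-< {suc p} {suc a} a<p = cong suc (skip-< (ℕP.≤-pred a<p))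

skip-≥ : ∀ {p a} → p ≤ a → skip p a ≡ suc a
skip-≥ {zero}  {a}     p≤a = refl
skip-≥ {suc p} {suc a} p≤a = cong suc (skip-≥ (ℕP.≤-pred p≤a))

skip-≢ : ∀ p a → skip p a ≢ p
skip-≢ zero    a       ()
skip-≢ (suc p) zero    ()
skip-≢ (suc p) (suc a) eq = skip-≢ p a (ℕP.suc-injective eq)

skip-injective : ∀ p {a b} → skip p a ≡ skip p b → a ≡ b
skip-injective zero    eq = ℕP.suc-injective eq
skip-injective (suc p) {zero}  {zero}  eq = refl
skip-injective (suc p) {suc a} {suc b} eq = cong suc (skip-injective p (ℕP.suc-injective eq))

skip-comm : ∀ {p q} a → p ≤ q → skip p (skip q a) ≡ skip (suc q) (skip p a)
skip-comm {zero}          a       p≤q = refl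
skip-comm {suc p} {suc q} zero    p≤q = refl
skip-comm {suc p} {suc q} (suc a) p≤q = cong suc (skip-comm a (ℕP.≤-pred p≤q))

skip-<ᵇ : ∀ p a → (skip p a <ᵇ p) ≡ (a <ᵇ p)
skip-<ᵇ zero    a       = refl
skip-<ᵇ (suc p) zero    = refl
skip-<ᵇ (suc p) (suc a) = skip-<ᵇ p a

skip-mono-< : ∀ p {a n} → a < n → skip p a < suc n
skip-mono-< zero    a<n = s≤s a<n
skip-mono-< (suc p) {zero}  a<n = s≤s z≤n
skip-mono-< (suc p) {suc a} {suc n} a<n = s≤s (skip-mono-< p (ℕP.≤-pred a<n))

ℕMatrix : Set
ℕMatrix = ℕ → ℕ → ℤ

restrict : ∀ {n} → ℕMatrix → Matrix n
restrict f a b = f (toℕ a) (toℕ b)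

Det : ℕ → ℕMatrix → ℤ
Det n f = det n (restrict f)

minorᴺ : ℕ → ℕ → ℕMatrix → ℕMatrix
minorᴺ r c f a b = f (skip r a) (skip c b)

deleteᴺ : ℕ → ℕMatrix → ℕMatrix
deleteᴺ p = minorᴺ p p

Det-cong : ∀ n {f g : ℕMatrix} → (∀ a b → a < n → b < n → f a b ≡ g a b) → Det n f ≡ Det n g
Det-cong n f≗g = det-cong n λ a b → f≗g (toℕ a) (toℕ b) (toℕ<n a) (toℕ<n b)

det-minor : ∀ n (f : ℕMatrix) (r c : Fin (suc n)) →
            det n (minor r c (restrict f)) ≡ Det n (minorᴺ (toℕ r) (toℕ c) f)
det-minor n f r c = det-cong n λ a b → cong₂ f (toℕ-punchIn r a) (toℕ-punchIn c b)

Det-row-single : ∀ n (f : ℕMatrix) {r c} → r < suc n → c < suc n → (∀ b → b < suc n → b ≢ c → f r b ≡ + 0) →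
                 Det (suc n) f ≡ sgn (r N.+ c) * f r c * Det n (minorᴺ r c f)
Det-row-single n f r< c< row≡0 with fromℕ< r< | toℕ-fromℕ< r< | fromℕ< c< | toℕ-fromℕ< c<
... | R | refl | C | refl =
  trans (det-row-single n (restrict f) R C λ b b≢C → row≡0 (toℕ b) (toℕ<n b) (b≢C ∘ toℕ-injective))
        (cong (sgn (toℕ R N.+ toℕ C) * f (toℕ R) (toℕ C) *_) (det-minor n f R C))

Det-col-single : ∀ n (f : ℕMatrix) {r c} → r < suc n → c < suc n → (∀ a → a < suc n → a ≢ r → f a c ≡ + 0) →
                 Det (suc n) f ≡ sgn (r N.+ c) * f r c * Det n (minorᴺ r c f)
Det-col-single n f r< c< col≡0 with fromℕ< r< | toℕ-fromℕ< r< | fromℕ< c< | toℕ-fromℕ< c<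
... | R | refl | C | refl =
  trans (det-col-single n (restrict f) R C λ a a≢R → col≡0 (toℕ a) (toℕ<n a) (a≢R ∘ toℕ-injective))
        (cong (sgn (toℕ R N.+ toℕ C) * f (toℕ R) (toℕ C) *_) (det-minor n f R C))

Det-row-linear : ∀ n (f g h : ℕMatrix) {r} → r < n → (c d : ℤ) →
  (∀ a b → a < n → b < n → a ≢ r → f a b ≡ g a b) → (∀ a b → a < n → b < n → a ≢ r → f a b ≡ h a b) →
  (∀ b → b < n → f r b ≡ c * g r b + d * h r b) → Det n f ≡ c * Det n g + d * Det n h
Det-row-linear n f g h r< c d f≗g f≗h row with fromℕ< r< | toℕ-fromℕ< r<
... | R | refl = det-row-linear n (restrict f) (restrict g) (restrict h) R c d
  (λ a a≢R b → f≗g (toℕ a) (toℕ b) (toℕ<n a) (toℕ<n b) (a≢R ∘ toℕ-injective))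
  (λ a a≢R b → f≗h (toℕ a) (toℕ b) (toℕ<n a) (toℕ<n b) (a≢R ∘ toℕ-injective))
  (λ b → row (toℕ b) (toℕ<n b))

ind : Bool → ℤ
ind b = if b then + 1 else + 0

≡ᵇ-refl : ∀ p → (p ≡ᵇ p) ≡ true
≡ᵇ-refl p = dec-true (p ≟ p) refl

≢⇒≡ᵇ-false : ∀ {a p} → a ≢ p → (a ≡ᵇ p) ≡ false
≢⇒≡ᵇ-false {a} {p} = dec-false (a ≟ p)

withRow : ℕ → (ℕ → ℤ) → ℕMatrix → ℕMatrix
withRow p ρ f a b = if a ≡ᵇ p then ρ b else f a b

unitRow : ℕ → ℕ → ℤ
unitRow q b = ind (b ≡ᵇ q)

unitRow-≡ : ∀ q → unitRow q q ≡ + 1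
unitRow-≡ q = cong ind (≡ᵇ-refl q)

unitRow-≢ : ∀ {q b} → b ≢ q → unitRow q b ≡ + 0
unitRow-≢ b≢q = cong ind (≢⇒≡ᵇ-false b≢q)

withRow-≡ : ∀ p ρ f b → withRow p ρ f p b ≡ ρ b
withRow-≡ p ρ f b = cong (λ t → if t then ρ b else f p b) (≡ᵇ-refl p)

withRow-≢ : ∀ {p a} ρ f b → a ≢ p → withRow p ρ f a b ≡ f a b
withRow-≢ {p} {a} ρ f b a≢p = cong (λ t → if t then ρ b else f a b) (≢⇒≡ᵇ-false a≢p)

atDiagonal : ℕ → ℕ → ℤ → ℤ
atDiagonal a b d = if a ≡ᵇ b then d else + 0

atDiagonal-≡ : ∀ a d → atDiagonal a a d ≡ d
atDiagonal-≡ a d = cong (λ t → if t then d else + 0) (≡ᵇ-refl a)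

atDiagonal-≢ : ∀ {a b} d → a ≢ b → atDiagonal a b d ≡ + 0
atDiagonal-≢ d a≢b = cong (λ t → if t then d else + 0) (≢⇒≡ᵇ-false a≢b)

Det-withRow-unitRow : ∀ n f {p q} → p < suc n → q < suc n →
                      Det (suc n) (withRow p (unitRow q) f) ≡ sgn (p N.+ q) * Det n (minorᴺ p q f)
Det-withRow-unitRow n f {p} {q} p< q< = begin
  Det (suc n) (withRow p (unitRow q) f)
    ≡⟨ Det-row-single n (withRow p (unitRow q) f) p< q<
         (λ b _ b≢q → trans (withRow-≡ p (unitRow q) f b) (unitRow-≢ b≢q)) ⟩
  sgn (p N.+ q) * withRow p (unitRow q) f p q * Det n (minorᴺ p q (withRow p (unitRow q) f))
    ≡⟨ cong₂ (λ e d → sgn (p N.+ q) * e * d)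
             (trans (withRow-≡ p (unitRow q) f q) (unitRow-≡ q))
             (Det-cong n λ a b _ _ → withRow-≢ (unitRow q) f (skip q b) (skip-≢ p a)) ⟩
  sgn (p N.+ q) * + 1 * Det n (minorᴺ p q f)
    ≡⟨ cong (_* Det n (minorᴺ p q f)) (ℤP.*-identityʳ (sgn (p N.+ q))) ⟩
  sgn (p N.+ q) * Det n (minorᴺ p q f) ∎
  where open ≡-Reasoning

Det-add-diagonal : ∀ n (f g : ℕMatrix) {p} (c : ℤ) → p < suc n →
  (∀ a b → a < suc n → b < suc n → a ≢ p ⊎ b ≢ p → f a b ≡ g a b) → f p p ≡ g p p + c →
  Det (suc n) f ≡ Det (suc n) g + c * Det n (deleteᴺ p g)
Det-add-diagonal n f g {p} c p< f≗g fpp = begin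
  Det (suc n) f
    ≡⟨ Det-row-linear (suc n) f g (withRow p (unitRow p) g) p< (+ 1) c
         (λ a b a< b< a≢p → f≗g a b a< b< (inj₁ a≢p))
         (λ a b a< b< a≢p → trans (f≗g a b a< b< (inj₁ a≢p)) (sym (withRow-≢ (unitRow p) g b a≢p)))
         row ⟩
  + 1 * Det (suc n) g + c * Det (suc n) (withRow p (unitRow p) g)
    ≡⟨ cong₂ (λ x y → x + c * y) (ℤP.*-identityˡ (Det (suc n) g)) (Det-withRow-unitRow n g p< p<) ⟩
  Det (suc n) g + c * (sgn (p N.+ p) * Det n (deleteᴺ p g))
    ≡⟨ cong (λ σ → Det (suc n) g + c * (σ * Det n (deleteᴺ p g))) (sgn-double p) ⟩
  Det (suc n) g + c * (+ 1 * Det n (deleteᴺ p g))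
    ≡⟨ cong (λ x → Det (suc n) g + c * x) (ℤP.*-identityˡ (Det n (deleteᴺ p g))) ⟩
  Det (suc n) g + c * Det n (deleteᴺ p g) ∎
  where
  open ≡-Reasoning
  row : ∀ b → b < suc n → f p b ≡ + 1 * g p b + c * withRow p (unitRow p) g p b
  row b b< with b ≟ p
  ... | yes refl = begin
    f p p                     ≡⟨ fpp ⟩
    g p p + c                 ≡⟨ on-diagonal (g p p) c ⟩
    + 1 * g p p + c * + 1     ≡⟨ cong (λ e → + 1 * g p p + c * e) (trans (withRow-≡ p (unitRow p) g p) (unitRow-≡ p)) ⟨
    + 1 * g p p + c * withRow p (unitRow p) g p p ∎
    where
    on-diagonal : ∀ x c → x + c ≡ + 1 * x + c * + 1
    on-diagonal = solve-∀
  ... | no b≢p = begin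
    f p b                     ≡⟨ f≗g p b p< b< (inj₂ b≢p) ⟩
    g p b                     ≡⟨ off-diagonal (g p b) c ⟩
    + 1 * g p b + c * + 0     ≡⟨ cong (λ e → + 1 * g p b + c * e) (trans (withRow-≡ p (unitRow p) g b) (unitRow-≢ b≢p)) ⟨
    + 1 * g p b + c * withRow p (unitRow p) g p b ∎
    where
    off-diagonal : ∀ x c → x ≡ + 1 * x + c * + 0
    off-diagonal = solve-∀

Det-minorᴺ-pendant : ∀ n (f : ℕMatrix) {u v′} → u ≤ v′ → v′ < suc n →
  (∀ a → a < suc (suc n) → a ≢ u → a ≢ suc v′ → f a (suc v′) ≡ + 0) →
  Det (suc n) (minorᴺ (suc v′) u f) ≡ sgn (u N.+ v′) * f u (suc v′) * Det n (deleteᴺ u (deleteᴺ (suc v′) f))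
Det-minorᴺ-pendant n f {u} {v′} u≤v′ v′< col≡0 = begin
  Det (suc n) (minorᴺ v u f)
    ≡⟨ Det-col-single n (minorᴺ v u f) (ℕP.≤-<-trans u≤v′ v′<) v′< col ⟩
  sgn (u N.+ v′) * f (skip v u) (skip u v′) * Det n (minorᴺ u v′ (minorᴺ v u f))
    ≡⟨ cong₂ (λ e d → sgn (u N.+ v′) * e * d) (cong₂ f (skip-< (s≤s u≤v′)) (skip-≥ u≤v′))
             (Det-cong n λ a b _ _ → cong (f (skip v (skip u a))) (skip-comm b u≤v′)) ⟩
  sgn (u N.+ v′) * f u v * Det n (deleteᴺ u (deleteᴺ v f)) ∎
  where
  open ≡-Reasoning
  v = suc v′
  col : ∀ a → a < suc n → a ≢ u → f (skip v a) (skip u v′) ≡ + 0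
  col a a< a≢u rewrite skip-≥ u≤v′ = col≡0 (skip v a) (skip-mono-< v a<)
    (λ eq → a≢u (skip-injective v (trans eq (sym (skip-< (s≤s u≤v′)))))) (skip-≢ v a)

-- Expand along the row of the pendant vertex v, then along the column of v in the term through u.
Det-pendant : ∀ n (f : ℕMatrix) {u v} → u < v → v < suc (suc n) →
  (∀ b → b < suc (suc n) → b ≢ u → b ≢ v → f v b ≡ + 0) →
  (∀ a → a < suc (suc n) → a ≢ u → a ≢ v → f a v ≡ + 0) →
  Det (suc (suc n)) f ≡ f v v * Det (suc n) (deleteᴺ v f) - f u v * f v u * Det n (deleteᴺ u (deleteᴺ v f))
Det-pendant n f {u} {suc v′} u<v v< row≡0 col≡0 = begin
  Det (suc (suc n)) f
    ≡⟨ Det-row-linear (suc (suc n)) f (withRow v (unitRow v) f) (withRow v (unitRow u) f) v< (f v v) (f v u)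
         (λ a b _ _ a≢v → sym (withRow-≢ (unitRow v) f b a≢v))
         (λ a b _ _ a≢v → sym (withRow-≢ (unitRow u) f b a≢v))
         row ⟩
  f v v * Det (suc (suc n)) (withRow v (unitRow v) f) + f v u * Det (suc (suc n)) (withRow v (unitRow u) f)
    ≡⟨ cong₂ (λ d₁ d₂ → f v v * d₁ + f v u * d₂)
             (Det-withRow-unitRow (suc n) f v< v<) (Det-withRow-unitRow (suc n) f v< (ℕP.<-trans u<v v<)) ⟩
  f v v * (sgn (v N.+ v) * D₁) + f v u * (sgn (v N.+ u) * Det (suc n) (minorᴺ v u f))
    ≡⟨ cong₂ (λ σ d → f v v * (σ * D₁) + f v u * (sgn (v N.+ u) * d))
             (sgn-double v) (Det-minorᴺ-pendant n f (ℕP.≤-pred u<v) (ℕP.≤-pred v<) col≡0) ⟩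
  f v v * (+ 1 * D₁) + f v u * (sgn (v N.+ u) * (sgn (u N.+ v′) * f u v * D₂))
    ≡⟨ combine (f v v) (f v u) (f u v) D₁ D₂ (sgn (v N.+ u)) (sgn (u N.+ v′)) (sgn-adjacent u v′) ⟩
  f v v * D₁ - f u v * f v u * D₂ ∎
  where
  open ≡-Reasoning
  v = suc v′
  D₁ = Det (suc n) (deleteᴺ v f)
  D₂ = Det n (deleteᴺ u (deleteᴺ v f))
  row : ∀ b → b < suc (suc n) → f v b ≡ f v v * withRow v (unitRow v) f v b + f v u * withRow v (unitRow u) f v b
  row b b< rewrite withRow-≡ v (unitRow v) f b | withRow-≡ v (unitRow u) f b with b ≟ v | b ≟ u
  ... | yes refl | _        rewrite unitRow-≡ v | unitRow-≢ (ℕP.>⇒≢ u<v) = pick-first (f v v) (f v u)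
    where
    pick-first : ∀ x y → x ≡ x * + 1 + y * + 0
    pick-first = solve-∀
  ... | no b≢v   | yes refl rewrite unitRow-≢ b≢v | unitRow-≡ u = pick-second (f v v) (f v u)
    where
    pick-second : ∀ x y → y ≡ x * + 0 + y * + 1
    pick-second = solve-∀
  ... | no b≢v   | no b≢u   rewrite unitRow-≢ b≢v | unitRow-≢ b≢u = trans (row≡0 b b< b≢u b≢v) (pick-none (f v v) (f v u))
    where
    pick-none : ∀ x y → + 0 ≡ x * + 0 + y * + 0
    pick-none = solve-∀
  combine : ∀ x y z d₁ d₂ σ τ → σ * τ ≡ -1ℤ → x * (+ 1 * d₁) + y * (σ * (τ * z * d₂)) ≡ x * d₁ - z * y * d₂
  combine x y z d₁ d₂ σ τ στ≡-1 = begin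
    x * (+ 1 * d₁) + y * (σ * (τ * z * d₂))   ≡⟨ regroup x y z d₁ d₂ σ τ ⟩
    x * d₁ + σ * τ * (z * y * d₂)             ≡⟨ cong (λ σ′ → x * d₁ + σ′ * (z * y * d₂)) στ≡-1 ⟩
    x * d₁ + -1ℤ * (z * y * d₂)               ≡⟨ subtract x z y d₁ d₂ ⟩
    x * d₁ - z * y * d₂                       ∎
    where
    regroup : ∀ x y z d₁ d₂ σ τ → x * (+ 1 * d₁) + y * (σ * (τ * z * d₂)) ≡ x * d₁ + σ * τ * (z * y * d₂)
    regroup = solve-∀
    subtract : ∀ x z y d₁ d₂ → x * d₁ + -1ℤ * (z * y * d₂) ≡ x * d₁ - z * y * d₂
    subtract = solve-∀

Σℤ-unitRow : ∀ {n p} → p < n → Σℤ n (λ v → unitRow p (toℕ v)) ≡ + 1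
Σℤ-unitRow {suc n} {zero}  p<n = cong (_+_ (+ 1)) (Σℤ-zero n λ v → refl)
Σℤ-unitRow {suc n} {suc p} p<n = cong (_+_ (+ 0)) (Σℤ-unitRow (ℕP.≤-pred p<n))

Σℤ-ind-< : ∀ {n s} → s ≤ n → Σℤ n (λ v → ind (toℕ v <ᵇ s)) ≡ + s
Σℤ-ind-< {n}     {zero}  s≤n = Σℤ-zero n λ v → refl
Σℤ-ind-< {suc n} {suc s} s≤n = cong (_+_ (+ 1)) (Σℤ-ind-< (ℕP.≤-pred s≤n))

module _ {P : ℕ → Set} (P? : ∀ b → Dec (P b)) where

  Σℤ-ind-unique : ∀ {n p} → p < n → (∀ b → P b ⇔ b ≡ p) → Σℤ n (λ v → ind (does (P? (toℕ v)))) ≡ + 1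
  Σℤ-ind-unique {n} {p} p<n P⇔≡p =
    trans (Σℤ-cong n λ v → cong ind (does-⇔ (P⇔≡p (toℕ v)) (P? (toℕ v)) (toℕ v ≟ p))) (Σℤ-unitRow p<n)

  Σℤ-ind-none : ∀ n → (∀ b → ¬ P b) → Σℤ n (λ v → ind (does (P? (toℕ v)))) ≡ + 0
  Σℤ-ind-none n ¬P = Σℤ-zero n λ v → cong ind (dec-false (P? (toℕ v)) (¬P (toℕ v)))

ind-⊎-dec : ∀ {A B : Set} (a? : Dec A) (b? : Dec B) → (A → ¬ B) → ind (does (a? ⊎-dec b?)) ≡ ind (does a?) + ind (does b?)
ind-⊎-dec (yes a) (yes b) a⇒¬b = ⊥-elim (a⇒¬b a b)
ind-⊎-dec (yes a) (no ¬b) a⇒¬b = refl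
ind-⊎-dec (no ¬a) (yes b) a⇒¬b = refl
ind-⊎-dec (no ¬a) (no ¬b) a⇒¬b = refl

-- The spider

-- SpiderArc s k a b: a is the parent of b when T(s,k) is rooted at the centre.
-- By definition, spiderAdj s k a b is does (spiderArc? s k a b).
SpiderArc : ℕ → ℕ → ℕ → ℕ → Set
SpiderArc s k a b = (a ≡ 0 × 1 ≤ b × b ≤ s) ⊎ (1 ≤ a × a ≤ k × b ≡ s N.+ a)

spiderArc? : ∀ s k a b → Dec (SpiderArc s k a b)
spiderArc? s k a b = (a ≟ 0 ×-dec 1 ≤? b ×-dec b ≤? s) ⊎-dec (1 ≤? a ×-dec a ≤? k ×-dec b ≟ s N.+ a)

SpiderEdge : ℕ → ℕ → ℕ → ℕ → Set
SpiderEdge s k a b = SpiderArc s k a b ⊎ SpiderArc s k b a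

spiderEdge? : ∀ s k a b → Dec (SpiderEdge s k a b)
spiderEdge? s k a b = spiderArc? s k a b ⊎-dec spiderArc? s k b a

SpiderArc⇒< : ∀ {s k a b} → k ≤ s → SpiderArc s k a b → a < b
SpiderArc⇒< k≤s (inj₁ (refl , 1≤b , _))   = 1≤b
SpiderArc⇒< k≤s (inj₂ (1≤a , a≤k , refl)) = ℕP.m<n+m _ (ℕP.≤-trans 1≤a (ℕP.≤-trans a≤k k≤s))

SpiderArc-asym : ∀ {s k a b} → k ≤ s → SpiderArc s k a b → ¬ SpiderArc s k b a
SpiderArc-asym k≤s ab ba = ℕP.<-asym (SpiderArc⇒< k≤s ab) (SpiderArc⇒< k≤s ba)

SpiderArc-skip : ∀ {s k} a b → k ≤ s → SpiderArc (suc s) k (skip (suc k) a) (skip (suc k) b) ⇔ SpiderArc s k a b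
SpiderArc-skip {s} {k} a b k≤s = ray ⊎-⇔ foot a
  where
  skip≡0 : ∀ a → skip (suc k) a ≡ 0 ⇔ a ≡ 0
  skip≡0 zero    = mk⇔ (λ eq → eq) (λ eq → eq)
  skip≡0 (suc a) = mk⇔ (λ ()) (λ ())
  1≤skip : ∀ b → 1 ≤ skip (suc k) b ⇔ 1 ≤ b
  1≤skip zero    = mk⇔ (λ le → le) (λ le → le)
  1≤skip (suc b) = mk⇔ (λ _ → s≤s z≤n) (λ _ → s≤s z≤n)
  skip≤ : skip (suc k) b ≤ suc s ⇔ b ≤ s
  skip≤ with b <? suc k
  ... | yes b<p rewrite skip-< b<p = mk⇔ (λ _ → ℕP.≤-trans (ℕP.≤-pred b<p) k≤s) ℕP.m≤n⇒m≤1+n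
  ... | no b≮p  rewrite skip-≥ (ℕP.≮⇒≥ b≮p) = mk⇔ ℕP.≤-pred s≤s
  ray : (skip (suc k) a ≡ 0 × 1 ≤ skip (suc k) b × skip (suc k) b ≤ suc s) ⇔ (a ≡ 0 × 1 ≤ b × b ≤ s)
  ray = mk⇔ (λ (p , q , r) → to (skip≡0 a) p , to (1≤skip b) q , to skip≤ r)
            (λ (p , q , r) → from (skip≡0 a) p , from (1≤skip b) q , from skip≤ r)
    where open Equivalence
  foot : ∀ a → (1 ≤ skip (suc k) a × skip (suc k) a ≤ k × skip (suc k) b ≡ suc s N.+ skip (suc k) a)
             ⇔ (1 ≤ a × a ≤ k × b ≡ s N.+ a)
  foot a with a <? suc k
  ... | yes a<p rewrite skip-< a<p =
    mk⇔ (λ (1≤a , a≤k , eq) → 1≤a , a≤k , skip-injective (suc k) (trans eq (sym (skip-≥ (p≤s+a 1≤a)))))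
        (λ (1≤a , a≤k , eq) → 1≤a , a≤k , trans (cong (skip (suc k)) eq) (skip-≥ (p≤s+a 1≤a)))
    where
    p≤s+a : 1 ≤ a → suc k ≤ s N.+ a
    p≤s+a 1≤a = ℕP.≤-trans (s≤s k≤s) (ℕP.≤-trans (ℕP.≤-reflexive (ℕP.+-comm 1 s)) (ℕP.+-monoʳ-≤ s 1≤a))
  ... | no a≮p rewrite skip-≥ (ℕP.≮⇒≥ a≮p) =
    mk⇔ (λ (_ , 1+a≤k , _) → ⊥-elim (a≮p (ℕP.m≤n⇒m≤1+n 1+a≤k)))
        (λ (_ , a≤k , _) → ⊥-elim (a≮p (s≤s a≤k)))

SpiderArc-shrink-legs : ∀ {s k} a {b} → b < s N.+ suc k → SpiderArc s (suc k) a b ⇔ SpiderArc s k a b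
SpiderArc-shrink-legs {s} {k} a {b} b< = mk⇔ (λ ray → ray) (λ ray → ray) ⊎-⇔ foot
  where
  foot : (1 ≤ a × a ≤ suc k × b ≡ s N.+ a) ⇔ (1 ≤ a × a ≤ k × b ≡ s N.+ a)
  foot = mk⇔ (λ (1≤a , _ , b≡s+a) → 1≤a , ℕP.≤-pred (ℕP.+-cancelˡ-< s a (suc k) (subst (_< s N.+ suc k) b≡s+a b<)) , b≡s+a)
             (λ (1≤a , a≤k , b≡s+a) → 1≤a , ℕP.m≤n⇒m≤1+n a≤k , b≡s+a)

SpiderEdge-ray-leaf : ∀ {s k b} → k ≤ s → SpiderEdge (suc s) k (suc k) b → b ≡ 0
SpiderEdge-ray-leaf k≤s (inj₁ (inj₁ (() , _)))
SpiderEdge-ray-leaf k≤s (inj₁ (inj₂ (_ , k<k , _)))          = ⊥-elim (ℕP.<-irrefl refl k<k)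
SpiderEdge-ray-leaf k≤s (inj₂ (inj₁ (b≡0 , _)))               = b≡0
SpiderEdge-ray-leaf {s} k≤s (inj₂ (inj₂ (1≤b , _ , eq))) =
  ⊥-elim (ℕP.<-irrefl (ℕP.suc-injective eq) (ℕP.≤-<-trans k≤s (ℕP.m<m+n s 1≤b)))

SpiderEdge-pendant : ∀ {s k b} → suc k ≤ s → SpiderEdge s (suc k) (s N.+ suc k) b → b ≡ suc k
SpiderEdge-pendant {s} k<s (inj₁ (inj₁ (v≡0 , _)))     = ⊥-elim (ℕP.m+1+n≢0 s v≡0)
SpiderEdge-pendant {s} k<s (inj₁ (inj₂ (_ , v≤k , _))) = ⊥-elim (ℕP.<⇒≱ (ℕP.m<n+m _ (ℕP.≤-trans (s≤s z≤n) k<s)) v≤k)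
SpiderEdge-pendant {s} k<s (inj₂ (inj₁ (_ , _ , v≤s))) = ⊥-elim (ℕP.<⇒≱ (ℕP.m<m+n s (s≤s z≤n)) v≤s)
SpiderEdge-pendant {s} k<s (inj₂ (inj₂ (_ , _ , eq)))  = sym (ℕP.+-cancelˡ-≡ s _ _ eq)

spiderDegree : ℕ → ℕ → ℕ → ℤ
spiderDegree s k zero    = + s
spiderDegree s k (suc a) = ind (a <ᵇ k) + + 1

module _ (s k : ℕ) where

  Σℤ-arcs-from-centre : Σℤ (suc (s N.+ k)) (λ v → ind (does (spiderArc? s k 0 (toℕ v)))) ≡ + s
  Σℤ-arcs-from-centre = cong (_+_ (+ 0)) (trans
    (Σℤ-cong (s N.+ k) λ w → cong ind (does-⇔ (ray-child (toℕ w)) (spiderArc? s k 0 (suc (toℕ w))) (toℕ w <? s)))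
    (Σℤ-ind-< (ℕP.m≤m+n s k)))
    where
    ray-child : ∀ w → SpiderArc s k 0 (suc w) ⇔ w < s
    ray-child w = mk⇔ (λ { (inj₁ (_ , _ , w<s)) → w<s ; (inj₂ (() , _)) })
                      (λ w<s → inj₁ (refl , s≤s z≤n , w<s))

  Σℤ-arcs-from-suc : ∀ a → Σℤ (suc (s N.+ k)) (λ v → ind (does (spiderArc? s k (suc a) (toℕ v)))) ≡ ind (a <ᵇ k)
  Σℤ-arcs-from-suc a with a <? k
  ... | yes a<k = trans (Σℤ-ind-unique (spiderArc? s k (suc a)) {suc (s N.+ k)} (s≤s (ℕP.+-monoʳ-≤ s a<k)) foot-child)
                        (sym (cong ind (dec-true (a <? k) a<k)))
    where
    foot-child : ∀ b → SpiderArc s k (suc a) b ⇔ b ≡ s N.+ suc a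
    foot-child b = mk⇔ (λ { (inj₁ (() , _)) ; (inj₂ (_ , _ , eq)) → eq })
                       (λ eq → inj₂ (s≤s z≤n , a<k , eq))
  ... | no a≮k = trans (Σℤ-ind-none (spiderArc? s k (suc a)) (suc (s N.+ k)) no-child)
                       (sym (cong ind (dec-false (a <? k) a≮k)))
    where
    no-child : ∀ b → ¬ SpiderArc s k (suc a) b
    no-child b (inj₁ (() , _))
    no-child b (inj₂ (_ , a<k , _)) = a≮k a<k

  Σℤ-arcs-into-centre : Σℤ (suc (s N.+ k)) (λ v → ind (does (spiderArc? s k (toℕ v) 0))) ≡ + 0
  Σℤ-arcs-into-centre = Σℤ-ind-none (λ b → spiderArc? s k b 0) (suc (s N.+ k)) no-parent
    where
    no-parent : ∀ b → ¬ SpiderArc s k b 0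
    no-parent b (inj₁ (_ , () , _))
    no-parent (suc b) (inj₂ (_ , _ , eq)) = ℕP.m+1+n≢0 s (sym eq)

  Σℤ-arcs-into-suc : ∀ {a} → a < s N.+ k → Σℤ (suc (s N.+ k)) (λ v → ind (does (spiderArc? s k (toℕ v) (suc a)))) ≡ + 1
  Σℤ-arcs-into-suc {a} a< with suc a ≤? s
  ... | yes a<s = Σℤ-ind-unique (λ b → spiderArc? s k b (suc a)) {suc (s N.+ k)} (s≤s z≤n) centre-parent
    where
    centre-parent : ∀ b → SpiderArc s k b (suc a) ⇔ b ≡ 0
    centre-parent b = mk⇔ (λ { (inj₁ (b≡0 , _)) → b≡0
                             ; (inj₂ (1≤b , _ , eq)) → ⊥-elim (ℕP.<⇒≱ (ℕP.m<m+n s 1≤b) (subst (_≤ s) eq a<s)) })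
                          (λ { refl → inj₁ (refl , s≤s z≤n , a<s) })
  ... | no a≮s with ℕP.m≤n⇒∃[o]m+o≡n (ℕP.≤-pred (ℕP.≰⇒> a≮s))
  ...   | i , s+i≡a = Σℤ-ind-unique (λ b → spiderArc? s k b (suc a)) {suc (s N.+ k)} i<n leg-parent
    where
    i<k : i < k
    i<k = ℕP.+-cancelˡ-< s i k (subst (_< s N.+ k) (sym s+i≡a) a<)
    i<n : suc i < suc (s N.+ k)
    i<n = s≤s (ℕP.≤-trans i<k (ℕP.m≤n+m k s))
    a≡s+1+i : suc a ≡ s N.+ suc i
    a≡s+1+i = sym (trans (ℕP.+-suc s i) (cong suc s+i≡a))
    leg-parent : ∀ b → SpiderArc s k b (suc a) ⇔ b ≡ suc i
    leg-parent b = mk⇔ (λ { (inj₁ (_ , _ , a<s)) → ⊥-elim (a≮s a<s)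
                          ; (inj₂ (_ , _ , eq)) → ℕP.+-cancelˡ-≡ s b (suc i) (trans (sym eq) a≡s+1+i) })
                       (λ { refl → inj₂ (s≤s z≤n , i<k , a≡s+1+i) })

Σℤ-spiderEdge : ∀ {s k} → k ≤ s → ∀ a → a < suc (s N.+ k) →
                Σℤ (suc (s N.+ k)) (λ v → ind (does (spiderEdge? s k a (toℕ v)))) ≡ spiderDegree s k a
Σℤ-spiderEdge {s} {k} k≤s a a< = begin
  Σℤ n (λ v → ind (does (spiderEdge? s k a (toℕ v))))
    ≡⟨ Σℤ-cong n (λ v → ind-⊎-dec (spiderArc? s k a (toℕ v)) (spiderArc? s k (toℕ v) a) (SpiderArc-asym k≤s)) ⟩
  Σℤ n (λ v → ind (does (spiderArc? s k a (toℕ v))) + ind (does (spiderArc? s k (toℕ v) a)))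
    ≡⟨ Σℤ-+ n (λ v → ind (does (spiderArc? s k a (toℕ v)))) (λ v → ind (does (spiderArc? s k (toℕ v) a))) ⟩
  Σℤ n (λ v → ind (does (spiderArc? s k a (toℕ v)))) + Σℤ n (λ v → ind (does (spiderArc? s k (toℕ v) a)))
    ≡⟨ children+parents a a< ⟩
  spiderDegree s k a ∎
  where
  open ≡-Reasoning
  n = suc (s N.+ k)
  children+parents : ∀ a → a < n →
    Σℤ n (λ v → ind (does (spiderArc? s k a (toℕ v)))) + Σℤ n (λ v → ind (does (spiderArc? s k (toℕ v) a)))
      ≡ spiderDegree s k a
  children+parents zero    _  = trans (cong₂ _+_ (Σℤ-arcs-from-centre s k) (Σℤ-arcs-into-centre s k)) (ℤP.+-identityʳ (+ s))
  children+parents (suc a) a< = cong₂ _+_ (Σℤ-arcs-from-suc s k a) (Σℤ-arcs-into-suc s k (ℕP.≤-pred a<))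

degree-spider : ∀ {s k} → k ≤ s → (u : Fin (s N.+ k N.+ 1)) → degree (spider s k) u ≡ spiderDegree s k (toℕ u)
degree-spider {s} {k} k≤s u = trans
  (cong (λ n → Σℤ n (λ v → ind (does (spiderEdge? s k (toℕ u) (toℕ v))))) (ℕP.+-comm (s N.+ k) 1))
  (Σℤ-spiderEdge k≤s (toℕ u) (subst (toℕ u <_) (ℕP.+-comm (s N.+ k) 1) (toℕ<n u)))

module SpiderMatrix (x : ℤ) where

  diagonal : ℕ → ℕ → ℤ → ℕ → ℤ
  diagonal s k y zero    = y
  diagonal s k y (suc a) = x - spiderDegree s k (suc a)

  -- xI - L of T(s,k), except that the centre's diagonal entry is a free parameter y.
  spiderMatrix : ℕ → ℕ → ℤ → ℕMatrix
  spiderMatrix s k y a b = atDiagonal a b (diagonal s k y a) + ind (does (spiderEdge? s k a b))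

  spiderDet : ℕ → ℕ → ℤ → ℤ
  spiderDet s k y = Det (suc (s N.+ k)) (spiderMatrix s k y)

  charPolyAt-spider : ∀ {s k} → k ≤ s → charPolyAt (laplacian (spider s k)) x ≡ spiderDet s k (x - + s)
  charPolyAt-spider {s} {k} k≤s =
    trans (det-cong (s N.+ k N.+ 1) entry) (cong (λ n → Det n (spiderMatrix s k (x - + s))) (ℕP.+-comm (s N.+ k) 1))
    where
    x-spiderDegree : ∀ a → x - spiderDegree s k a ≡ diagonal s k (x - + s) a
    x-spiderDegree zero    = refl
    x-spiderDegree (suc a) = refl
    entry : ∀ u v → atDiagonal (toℕ u) (toℕ v) x - laplacian (spider s k) u v
                    ≡ spiderMatrix s k (x - + s) (toℕ u) (toℕ v)
    entry u v with toℕ u ≡ᵇ toℕ v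
    ... | true  = begin
      x - (degree (spider s k) u - ind (spider s k u v))  ≡⟨ regroup x (degree (spider s k) u) (ind (spider s k u v)) ⟩
      x - degree (spider s k) u + ind (spider s k u v)    ≡⟨ cong (λ d → x - d + ind (spider s k u v)) (degree-spider k≤s u) ⟩
      x - spiderDegree s k (toℕ u) + ind (spider s k u v) ≡⟨ cong (_+ ind (spider s k u v)) (x-spiderDegree (toℕ u)) ⟩
      diagonal s k (x - + s) (toℕ u) + ind (spider s k u v) ∎
      where
      open ≡-Reasoning
      regroup : ∀ x d a → x - (d - a) ≡ x - d + a
      regroup = solve-∀
    ... | false = cancel (ind (spider s k u v))
      where
      cancel : ∀ a → + 0 - (+ 0 - a) ≡ + 0 + a
      cancel = solve-∀

  spiderMatrix-diagonal : ∀ {s k y} → k ≤ s → ∀ a → spiderMatrix s k y a a ≡ diagonal s k y a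
  spiderMatrix-diagonal {s} {k} {y} k≤s a = trans
    (cong₂ _+_ (atDiagonal-≡ a (diagonal s k y a)) (cong ind (dec-false (spiderEdge? s k a a) no-loop)))
    (ℤP.+-identityʳ (diagonal s k y a))
    where
    no-loop : ¬ SpiderEdge s k a a
    no-loop (inj₁ aa) = ℕP.<-irrefl refl (SpiderArc⇒< k≤s aa)
    no-loop (inj₂ aa) = ℕP.<-irrefl refl (SpiderArc⇒< k≤s aa)

  spiderMatrix-leaf : ∀ {s k y a} → k ≤ s → k ≤ a → spiderMatrix s k y (suc a) (suc a) ≡ x - + 1
  spiderMatrix-leaf {s} {k} {y} {a} k≤s k≤a =
    trans (spiderMatrix-diagonal {y = y} k≤s (suc a)) (cong (λ t → x - (ind t + + 1)) (dec-false (a <? k) (ℕP.≤⇒≯ k≤a)))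

  spiderMatrix-edge : ∀ {s k y a b} → a ≢ b → SpiderEdge s k a b → spiderMatrix s k y a b ≡ + 1
  spiderMatrix-edge {s} {k} {y} {a} {b} a≢b ab =
    cong₂ _+_ (atDiagonal-≢ (diagonal s k y a) a≢b) (cong ind (dec-true (spiderEdge? s k a b) ab))

  spiderMatrix-non-edge : ∀ {s k y a b} → a ≢ b → ¬ SpiderEdge s k a b → spiderMatrix s k y a b ≡ + 0
  spiderMatrix-non-edge {s} {k} {y} {a} {b} a≢b ¬ab =
    cong₂ _+_ (atDiagonal-≢ (diagonal s k y a) a≢b) (cong ind (dec-false (spiderEdge? s k a b) ¬ab))

  spiderMatrix-skip : ∀ {s k y} → k ≤ s → ∀ a b →
                      spiderMatrix (suc s) k y (skip (suc k) a) (skip (suc k) b) ≡ spiderMatrix s k y a b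
  spiderMatrix-skip {s} {k} {y} k≤s a b = cong₂ _+_ (diagonal-part a b)
    (cong ind (does-⇔ (SpiderArc-skip a b k≤s ⊎-⇔ SpiderArc-skip b a k≤s) (spiderEdge? (suc s) k _ _) (spiderEdge? s k a b)))
    where
    diagonal-skip : ∀ a → diagonal (suc s) k y (skip (suc k) a) ≡ diagonal s k y a
    diagonal-skip zero    = refl
    diagonal-skip (suc a) = cong (λ t → x - (ind t + + 1)) (skip-<ᵇ k a)
    diagonal-part : ∀ a b → atDiagonal (skip (suc k) a) (skip (suc k) b) (diagonal (suc s) k y (skip (suc k) a))
                            ≡ atDiagonal a b (diagonal s k y a)
    diagonal-part a b with a ≟ b
    ... | yes refl = trans (atDiagonal-≡ (skip (suc k) a) _) (trans (diagonal-skip a) (sym (atDiagonal-≡ a _)))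
    ... | no a≢b   = trans (atDiagonal-≢ _ (a≢b ∘ skip-injective (suc k))) (sym (atDiagonal-≢ _ a≢b))

  spiderMatrix-shrink-legs : ∀ {s k y a b} → a < s N.+ suc k → b < s N.+ suc k → a ≢ suc k ⊎ b ≢ suc k →
                             spiderMatrix s (suc k) y a b ≡ spiderMatrix s k y a b
  spiderMatrix-shrink-legs {s} {k} {y} {a} {b} a< b< off-root = cong₂ _+_ diagonal-part
    (cong ind (does-⇔ (SpiderArc-shrink-legs a b< ⊎-⇔ SpiderArc-shrink-legs b a<)
                      (spiderEdge? s (suc k) a b) (spiderEdge? s k a b)))
    where
    diagonal-shrink : ∀ a → a ≢ suc k → diagonal s (suc k) y a ≡ diagonal s k y a
    diagonal-shrink zero    _       = refl
    diagonal-shrink (suc a) a≢1+k = cong (λ t → x - (ind t + + 1)) (does-⇔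
      (mk⇔ (λ a<1+k → ℕP.≤∧≢⇒< (ℕP.≤-pred a<1+k) (a≢1+k ∘ cong suc)) ℕP.m<n⇒m<1+n) (a <? suc k) (a <? k))
    diagonal-part : atDiagonal a b (diagonal s (suc k) y a) ≡ atDiagonal a b (diagonal s k y a)
    diagonal-part with a ≟ b
    ... | yes refl = cong (atDiagonal a a) (diagonal-shrink a (reduce off-root))
    ... | no a≢b   = trans (atDiagonal-≢ _ a≢b) (sym (atDiagonal-≢ _ a≢b))

  spiderMatrix-leg-root : ∀ {s k y} → suc k ≤ s →
                          spiderMatrix s (suc k) y (suc k) (suc k) ≡ spiderMatrix s k y (suc k) (suc k) + -1ℤ
  spiderMatrix-leg-root {s} {k} {y} k<s = begin
    spiderMatrix s (suc k) y (suc k) (suc k)   ≡⟨ spiderMatrix-diagonal {y = y} k<s (suc k) ⟩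
    x - (ind (k <ᵇ suc k) + + 1)               ≡⟨ cong (λ t → x - (ind t + + 1)) (dec-true (k <? suc k) ℕP.≤-refl) ⟩
    x - + 2                                    ≡⟨ one-less x ⟩
    x - + 1 + -1ℤ                              ≡⟨ cong (_+ -1ℤ) (spiderMatrix-leaf {y = y} (ℕP.<⇒≤ k<s) ℕP.≤-refl) ⟨
    spiderMatrix s k y (suc k) (suc k) + -1ℤ   ∎
    where
    open ≡-Reasoning
    one-less : ∀ x → x - + 2 ≡ x - + 1 + -1ℤ
    one-less = solve-∀

  forestDet : ℕ → ℕ → ℤ
  forestDet s k = Det (s N.+ k) (deleteᴺ 0 (spiderMatrix s k (+ 0)))

  spiderDet-centre : ∀ s k y → spiderDet s k y ≡ spiderDet s k (+ 0) + y * forestDet s k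
  spiderDet-centre s k y =
    Det-add-diagonal (s N.+ k) (spiderMatrix s k y) (spiderMatrix s k (+ 0)) y (s≤s z≤n) off-centre (shift y)
    where
    off-centre : ∀ a b → a < suc (s N.+ k) → b < suc (s N.+ k) → a ≢ 0 ⊎ b ≢ 0 →
                 spiderMatrix s k y a b ≡ spiderMatrix s k (+ 0) a b
    off-centre (suc a) b       _ _ _         = refl
    off-centre zero    (suc b) _ _ _         = refl
    off-centre zero    zero    _ _ (inj₁ ne) = ⊥-elim (ne refl)
    off-centre zero    zero    _ _ (inj₂ ne) = ⊥-elim (ne refl)
    shift : ∀ y → y + + 0 ≡ + 0 + + 0 + y
    shift = solve-∀

  spiderDet-delete-ray-leaf : ∀ s k y → k ≤ s →
                              Det (suc (s N.+ k)) (deleteᴺ (suc k) (spiderMatrix (suc s) k y)) ≡ spiderDet s k y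
  spiderDet-delete-ray-leaf s k y k≤s = Det-cong (suc (s N.+ k)) λ a b _ _ → spiderMatrix-skip {y = y} k≤s a b

  spiderDet-ray : ∀ s k y → k ≤ s → spiderDet (suc s) k y ≡ (x - + 1) * spiderDet s k y - forestDet s k
  spiderDet-ray s k y k≤s = begin
    spiderDet (suc s) k y
      ≡⟨ Det-pendant (s N.+ k) M (s≤s z≤n) (s≤s (s≤s (ℕP.m≤n+m k s))) row≡0 col≡0 ⟩
    M v v * Det (suc (s N.+ k)) (deleteᴺ v M) - M 0 v * M v 0 * Det (s N.+ k) (deleteᴺ 0 (deleteᴺ v M))
      ≡⟨ cong₂ (λ m d → m * d - M 0 v * M v 0 * Det (s N.+ k) (deleteᴺ 0 (deleteᴺ v M)))
               (spiderMatrix-leaf {y = y} (ℕP.m≤n⇒m≤1+n k≤s) ℕP.≤-refl)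
               (spiderDet-delete-ray-leaf s k y k≤s) ⟩
    (x - + 1) * spiderDet s k y - M 0 v * M v 0 * Det (s N.+ k) (deleteᴺ 0 (deleteᴺ v M))
      ≡⟨ cong₂ (λ e d → (x - + 1) * spiderDet s k y - e * d)
               (cong₂ _*_ (spiderMatrix-edge {y = y} (λ ()) (inj₁ ray)) (spiderMatrix-edge {y = y} (λ ()) (inj₂ ray)))
               (Det-cong (s N.+ k) λ a b _ _ → spiderMatrix-skip {y = y} k≤s (suc a) (suc b)) ⟩
    (x - + 1) * spiderDet s k y - + 1 * + 1 * forestDet s k
      ≡⟨ cong (λ f → (x - + 1) * spiderDet s k y - f) (ℤP.*-identityˡ (forestDet s k)) ⟩
    (x - + 1) * spiderDet s k y - forestDet s k ∎
    where
    open ≡-Reasoning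
    M = spiderMatrix (suc s) k y
    v = suc k
    ray : SpiderArc (suc s) k 0 v
    ray = inj₁ (refl , s≤s z≤n , s≤s k≤s)
    row≡0 : ∀ b → b < suc (suc (s N.+ k)) → b ≢ 0 → b ≢ v → M v b ≡ + 0
    row≡0 b _ b≢0 b≢v = spiderMatrix-non-edge {y = y} (b≢v ∘ sym) (b≢0 ∘ SpiderEdge-ray-leaf k≤s)
    col≡0 : ∀ a → a < suc (suc (s N.+ k)) → a ≢ 0 → a ≢ v → M a v ≡ + 0
    col≡0 a _ a≢0 a≢v = spiderMatrix-non-edge {y = y} a≢v (a≢0 ∘ SpiderEdge-ray-leaf k≤s ∘ swap)

  module _ (s k : ℕ) (y : ℤ) (k≤s : k ≤ s) where
    private
      n = s N.+ suc k
      M = spiderMatrix (suc s) (suc k) y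
      Mₖ = spiderMatrix (suc s) k y
      foot = suc n

      M≗Mₖ : ∀ {a b} → a < foot → b < foot → a ≢ suc k ⊎ b ≢ suc k → M a b ≡ Mₖ a b
      M≗Mₖ = spiderMatrix-shrink-legs

      delete-ray-leaf : Det n (deleteᴺ (suc k) Mₖ) ≡ spiderDet s k y
      delete-ray-leaf = trans (cong (λ m → Det m (deleteᴺ (suc k) Mₖ)) (ℕP.+-suc s k)) (spiderDet-delete-ray-leaf s k y k≤s)

    spiderDet-delete-foot : Det (suc n) (deleteᴺ foot M) ≡ spiderDet (suc s) k y - spiderDet s k y
    spiderDet-delete-foot = begin
      Det (suc n) (deleteᴺ foot M)
        ≡⟨ Det-cong (suc n) (λ a b a< b< → cong₂ M (skip-< a<) (skip-< b<)) ⟩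
      Det (suc n) M
        ≡⟨ Det-add-diagonal n M Mₖ -1ℤ (s≤s (ℕP.m≤n+m (suc k) s))
             (λ a b a< b< → M≗Mₖ a< b<) (spiderMatrix-leg-root {y = y} (s≤s k≤s)) ⟩
      Det (suc n) Mₖ + -1ℤ * Det n (deleteᴺ (suc k) Mₖ)
        ≡⟨ cong₂ (λ d d′ → d + -1ℤ * d′) (cong (λ m → Det (suc m) Mₖ) (ℕP.+-suc s k)) delete-ray-leaf ⟩
      spiderDet (suc s) k y + -1ℤ * spiderDet s k y
        ≡⟨ subtract (spiderDet (suc s) k y) (spiderDet s k y) ⟩
      spiderDet (suc s) k y - spiderDet s k y ∎
      where
      open ≡-Reasoning
      subtract : ∀ d d′ → d + -1ℤ * d′ ≡ d - d′
      subtract = solve-∀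

    spiderDet-delete-leg : Det n (deleteᴺ (suc k) (deleteᴺ foot M)) ≡ spiderDet s k y
    spiderDet-delete-leg = trans
      (Det-cong n λ a b a< b< → trans (cong₂ M (skip-< (skip-mono-< (suc k) a<)) (skip-< (skip-mono-< (suc k) b<)))
                                      (M≗Mₖ (skip-mono-< (suc k) a<) (skip-mono-< (suc k) b<) (inj₁ (skip-≢ (suc k) a))))
      delete-ray-leaf

  spiderDet-leg : ∀ s k y → k ≤ s →
                  spiderDet (suc s) (suc k) y ≡ (x - + 1) * (spiderDet (suc s) k y - spiderDet s k y) - spiderDet s k y
  spiderDet-leg s k y k≤s = begin
    spiderDet (suc s) (suc k) y
      ≡⟨ Det-pendant n M u<v ℕP.≤-refl row≡0 col≡0 ⟩
    M v v * Det (suc n) (deleteᴺ v M) - M u v * M v u * Det n (deleteᴺ u (deleteᴺ v M))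
      ≡⟨ cong₂ (λ m e → m * Det (suc n) (deleteᴺ v M) - e * Det n (deleteᴺ u (deleteᴺ v M)))
               (spiderMatrix-leaf {y = y} (s≤s k≤s) (ℕP.m≤n+m (suc k) s))
               (cong₂ _*_ (spiderMatrix-edge {y = y} (ℕP.<⇒≢ u<v) (inj₁ foot))
                          (spiderMatrix-edge {y = y} (ℕP.>⇒≢ u<v) (inj₂ foot))) ⟩
    (x - + 1) * Det (suc n) (deleteᴺ v M) - + 1 * + 1 * Det n (deleteᴺ u (deleteᴺ v M))
      ≡⟨ cong₂ (λ d d′ → (x - + 1) * d - + 1 * + 1 * d′) (spiderDet-delete-foot s k y k≤s) (spiderDet-delete-leg s k y k≤s) ⟩
    (x - + 1) * (spiderDet (suc s) k y - spiderDet s k y) - + 1 * + 1 * spiderDet s k y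
      ≡⟨ cong (λ d → (x - + 1) * (spiderDet (suc s) k y - spiderDet s k y) - d) (ℤP.*-identityˡ (spiderDet s k y)) ⟩
    (x - + 1) * (spiderDet (suc s) k y - spiderDet s k y) - spiderDet s k y ∎
    where
    open ≡-Reasoning
    n = s N.+ suc k
    M = spiderMatrix (suc s) (suc k) y
    u = suc k
    v = suc n
    u<v : u < v
    u<v = s≤s (ℕP.m≤n+m (suc k) s)
    foot : SpiderArc (suc s) (suc k) u v
    foot = inj₂ (s≤s z≤n , ℕP.≤-refl , refl)
    row≡0 : ∀ b → b < suc v → b ≢ u → b ≢ v → M v b ≡ + 0
    row≡0 b _ b≢u b≢v = spiderMatrix-non-edge {y = y} (b≢v ∘ sym) (b≢u ∘ SpiderEdge-pendant (s≤s k≤s))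
    col≡0 : ∀ a → a < suc v → a ≢ u → a ≢ v → M a v ≡ + 0
    col≡0 a _ a≢u a≢v = spiderMatrix-non-edge {y = y} a≢v (a≢u ∘ SpiderEdge-pendant (s≤s k≤s) ∘ swap)

  E P : ℤ
  E = x - + 1
  P = x * x - + 3 * x + + 1

  -- n * X ^ (n - 1), the derivative of X ^ n, defined without a truncated exponent.
  powDeriv : ℤ → ℕ → ℤ
  powDeriv X zero    = + 0
  powDeriv X (suc n) = X ^ n + X * powDeriv X n

  powDeriv-suc : ∀ X n → powDeriv X (suc n) ≡ + suc n * X ^ n
  powDeriv-suc X zero    = first-power X
    where
    first-power : ∀ X → + 1 + X * + 0 ≡ + 1 * + 1
    first-power = solve-∀
  powDeriv-suc X (suc n) = trans (cong (λ d → X * X ^ n + X * d) (powDeriv-suc X n)) (next-power X (X ^ n) (+ suc n))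
    where
    next-power : ∀ X e m → X * e + X * (m * e) ≡ (+ 1 + m) * (X * e)
    next-power = solve-∀

  -- The centre entry y times the product of the branch determinants (P for a leg, E for a ray),
  -- minus, for each branch, the same product with that branch's root deleted.
  closedForm : ℕ → ℕ → ℤ → ℤ
  closedForm k b y = y * (E ^ b * P ^ k) - (E ^ suc b * powDeriv P k + powDeriv E b * P ^ k)

  forestDet≡spiderDet-difference : ∀ s k → forestDet s k ≡ spiderDet s k (+ 1) - spiderDet s k (+ 0)
  forestDet≡spiderDet-difference s k = solve-for (spiderDet-centre s k (+ 1))
    where
    solve-for : ∀ {d₁ d₀ f} → d₁ ≡ d₀ + + 1 * f → f ≡ d₁ - d₀
    solve-for {d₁} {d₀} {f} refl = isolate d₀ f
      where
      isolate : ∀ d₀ f → f ≡ d₀ + + 1 * f - d₀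
      isolate = solve-∀

  spiderDet-star : ∀ b y → spiderDet b 0 y ≡ closedForm 0 b y
  spiderDet-star zero    y = single-vertex x y
    where
    single-vertex : ∀ x y → + 1 * (y + + 0) * + 1 + + 0 ≡ y * (+ 1 * + 1) - ((x - + 1) * + 1 * + 0 + + 0 * + 1)
    single-vertex = solve-∀
  spiderDet-star (suc b) y = begin
    spiderDet (suc b) 0 y
      ≡⟨ spiderDet-ray b 0 y z≤n ⟩
    E * spiderDet b 0 y - forestDet b 0
      ≡⟨ cong (λ f → E * spiderDet b 0 y - f) (forestDet≡spiderDet-difference b 0) ⟩
    E * spiderDet b 0 y - (spiderDet b 0 (+ 1) - spiderDet b 0 (+ 0))
      ≡⟨ cong₂ (λ d d′ → E * d - d′) (spiderDet-star b y)
               (cong₂ _-_ (spiderDet-star b (+ 1)) (spiderDet-star b (+ 0))) ⟩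
    E * closedForm 0 b y - (closedForm 0 b (+ 1) - closedForm 0 b (+ 0))
      ≡⟨ add-ray x y (E ^ b) (powDeriv E b) ⟩
    closedForm 0 (suc b) y ∎
    where
    open ≡-Reasoning
    add-ray : ∀ x y e d →
      (x - + 1) * (y * (e * + 1) - ((x - + 1) * e * + 0 + d * + 1))
        - ((+ 1 * (e * + 1) - ((x - + 1) * e * + 0 + d * + 1)) - (+ 0 * (e * + 1) - ((x - + 1) * e * + 0 + d * + 1)))
      ≡ y * ((x - + 1) * e * + 1) - ((x - + 1) * ((x - + 1) * e) * + 0 + (e + (x - + 1) * d) * + 1)
    add-ray = solve-∀

  spiderDet-closed : ∀ k b y → spiderDet (k N.+ b) k y ≡ closedForm k b y
  spiderDet-closed zero    b y = spiderDet-star b y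
  spiderDet-closed (suc k) b y = begin
    spiderDet (suc (k N.+ b)) (suc k) y
      ≡⟨ spiderDet-leg (k N.+ b) k y (ℕP.m≤m+n k b) ⟩
    E * (spiderDet (suc (k N.+ b)) k y - spiderDet (k N.+ b) k y) - spiderDet (k N.+ b) k y
      ≡⟨ cong₂ (λ d₁ d₀ → E * (d₁ - d₀) - d₀) longer-ray (spiderDet-closed k b y) ⟩
    E * (closedForm k (suc b) y - closedForm k b y) - closedForm k b y
      ≡⟨ add-leg x y (E ^ b) (P ^ k) (powDeriv E b) (powDeriv P k) ⟩
    closedForm (suc k) b y ∎
    where
    open ≡-Reasoning
    longer-ray : spiderDet (suc (k N.+ b)) k y ≡ closedForm k (suc b) y
    longer-ray = trans (cong (λ s → spiderDet s k y) (sym (ℕP.+-suc k b))) (spiderDet-closed k (suc b) y)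
    add-leg : ∀ x y e p d d′ →
      (x - + 1) * ((y * ((x - + 1) * e * p) - ((x - + 1) * ((x - + 1) * e) * d′ + (e + (x - + 1) * d) * p))
                   - (y * (e * p) - ((x - + 1) * e * d′ + d * p)))
        - (y * (e * p) - ((x - + 1) * e * d′ + d * p))
      ≡ y * (e * ((x * x - + 3 * x + + 1) * p))
        - ((x - + 1) * e * (p + (x * x - + 3 * x + + 1) * d′) + d * ((x * x - + 3 * x + + 1) * p))
    add-leg = solve-∀

  cubic : ℕ → ℕ → ℤ
  cubic s k = x * x * x - + (s N.+ 4) * (x * x) + + (3 N.* s N.+ 4) * x - + (s N.+ k N.+ 1)

  closedForm-factor : ∀ {s k b} → s ≡ suc k N.+ suc b →
                      closedForm (suc k) (suc b) (x - + s) ≡ x * P ^ k * E ^ b * cubic s (suc k)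
  closedForm-factor {k = k} {b} refl = begin
    closedForm (suc k) (suc b) (x - + s)
      ≡⟨ cong₂ (λ d d′ → (x - + s) * (E ^ suc b * P ^ suc k) - (E ^ suc (suc b) * d + d′ * P ^ suc k))
               (powDeriv-suc P k) (powDeriv-suc E b) ⟩
    (x - + s) * (E ^ suc b * P ^ suc k) - (E ^ suc (suc b) * (K * P ^ k) + B * E ^ b * P ^ suc k)
      ≡⟨ cong (λ S → (x - S) * (E ^ suc b * P ^ suc k) - (E ^ suc (suc b) * (K * P ^ k) + B * E ^ b * P ^ suc k)) s≡K+B ⟩
    (x - (K + B)) * (E ^ suc b * P ^ suc k) - (E ^ suc (suc b) * (K * P ^ k) + B * E ^ b * P ^ suc k)
      ≡⟨ factor x (E ^ b) (P ^ k) K B ⟩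
    x * P ^ k * E ^ b * (x * x * x - (K + B + + 4) * (x * x) + (+ 3 * (K + B) + + 4) * x - (K + B + K + + 1))
      ≡⟨ cong (λ S → x * P ^ k * E ^ b * (x * x * x - (S + + 4) * (x * x) + (+ 3 * S + + 4) * x - (S + K + + 1))) s≡K+B ⟨
    x * P ^ k * E ^ b * (x * x * x - (+ s + + 4) * (x * x) + (+ 3 * + s + + 4) * x - (+ s + K + + 1))
      ≡⟨ cong (x * P ^ k * E ^ b *_) cubic-cast ⟨
    x * P ^ k * E ^ b * cubic s (suc k) ∎
    where
    open ≡-Reasoning
    s = suc k N.+ suc b
    K = + suc k
    B = + suc b
    s≡K+B : + s ≡ K + B
    s≡K+B = ℤP.pos-+ (suc k) (suc b)
    cubic-cast : cubic s (suc k) ≡ x * x * x - (+ s + + 4) * (x * x) + (+ 3 * + s + + 4) * x - (+ s + K + + 1)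
    cubic-cast rewrite ℤP.pos-+ s 4 | ℤP.pos-+ (3 N.* s) 4 | ℤP.pos-* 3 s
                     | ℤP.pos-+ (s N.+ suc k) 1 | ℤP.pos-+ s (suc k) = refl
    factor : ∀ x e p K B →
      (x - (K + B)) * ((x - + 1) * e * ((x * x - + 3 * x + + 1) * p))
        - ((x - + 1) * ((x - + 1) * e) * (K * p) + B * e * ((x * x - + 3 * x + + 1) * p))
      ≡ x * p * e * (x * x * x - (K + B + + 4) * (x * x) + (+ 3 * (K + B) + + 4) * x - (K + B + K + + 1))
    factor = solve-∀

proposition3p2 : (s k : ℕ) → 1 ≤ k → k < s → (x : ℤ) →
    charPolyAt (laplacian (spider s k)) x
      ≡ x * ((x * x - + 3 * x + + 1) ^ (k ∸ 1)) * ((x - + 1) ^ (s ∸ k ∸ 1))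
          * (x * x * x - + (s N.+ 4) * (x * x) + + (3 N.* s N.+ 4) * x - + (s N.+ k N.+ 1))
proposition3p2 s (suc k) _ k<s x = begin
  charPolyAt (laplacian (spider s (suc k))) x     ≡⟨ charPolyAt-spider (ℕP.<⇒≤ k<s) ⟩
  spiderDet s (suc k) (x - + s)                    ≡⟨ cong (λ m → spiderDet m (suc k) (x - + s)) s≡k+b ⟩
  spiderDet (suc k N.+ suc b) (suc k) (x - + s)    ≡⟨ spiderDet-closed (suc k) (suc b) (x - + s) ⟩
  closedForm (suc k) (suc b) (x - + s)             ≡⟨ closedForm-factor s≡k+b ⟩
  x * P ^ k * E ^ b * cubic s (suc k)              ∎
  where
  open ≡-Reasoning
  open SpiderMatrix x
  b = s ∸ suc k ∸ 1
  s≡k+b : s ≡ suc k N.+ suc b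
  s≡k+b = trans (sym (ℕP.m+[n∸m]≡n (ℕP.<⇒≤ k<s))) (cong (suc k N.+_) (sym (ℕP.m+[n∸m]≡n (ℕP.m<n⇒0<n∸m k<s))))
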